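{- Let $G = G_1 \times G_2$ and $G' = G_1' \times G_2'$ be two groups of order $2^{2n}$. Let $D_1, D_2, D_1', D_2'$ be difference sets with the symmetric difference property in $G_1, G_2, G_1', G_2'$ respectively, and suppose that \[D = \big(D_1 \times (G_2 - D_2)\big) \cup \big((G_1 - D_1) \times D_2\big), \qquad D' = \big(D_1' \times (G_2' - D_2')\big) \cup \big((G_1' - D_1') \times D_2'\big)\] are difference sets with the symmetric difference property in $G$ and $G'$ respectively. If the development of $D_1$ is isomorphic to the development of $D_1'$ and the development of $D_2$ is isomorphic to the development of $D_2'$, then the development of $D$ is isomorphic to the development of $D'$.
   Context: A $(v,k,\lambda)$ difference set in a group $G$ of order $v$ is a subset $D$ of size $k$ such that the multiset $\{d_1 d_2^{ -1} : d_1,d_2 \in D\}$ contains every non-identity element of $G$ exactly $\lambda$ times. Its development is the symmetric design with points the elements of $G$, blocks the left translates $gD$ ($g\in G$), incidence by membership. A symmetric design has the symmetric difference property (SDP) if the symmetric difference of any three blocks is a block or the complement of a block; a difference set has the SDP if its development does. Two symmetric designs are isomorphic if there is a bijection between their point sets preserving incidence, equivalently their incidence matrices satisfy $A_1 = P A_2 Q$ for some permutation matrices $P, Q$. -}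

module Defs where

open import Data.Nat using (ℕ; zero; suc; _+_; _*_)
open import Data.Fin using (Fin; zero; suc)
open import Data.Fin.Properties using (*↔×) renaming (_≟_ to _≟F_)
open import Data.Bool using (Bool; true; false; _∧_; _∨_; _xor_; not; if_then_else_)
open import Data.Sum using (_⊎_)
open import Data.Product using (Σ; ∃; _×_; _,_; proj₁; proj₂)
open import Data.Product.Function.NonDependent.Propositional using (_×-↔_)
open import Function.Bundles using (_↔_; Inverse)
open import Function.Properties.Inverse using (↔-trans; ↔-sym)
open import Relation.Binary.PropositionalEquality using (_≡_; _≢_; refl; cong; cong₂; isEquivalence)
open import Relation.Nullary.Decidable using (⌊_⌋)
open import Algebra.Structures using (IsGroup)

record FinGroup : Set₁ where
  field
    Carrier : Set
    _∙_     : Carrier → Carrier → Carrier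
    ε       : Carrier
    _⁻¹     : Carrier → Carrier
    isGroup : IsGroup _≡_ _∙_ ε _⁻¹
    order   : ℕ
    enum    : Carrier ↔ Fin order

  toF : Carrier → Fin order
  toF = Inverse.to enum

  fromF : Fin order → Carrier
  fromF = Inverse.from enum

  eqB : Carrier → Carrier → Bool
  eqB x y = ⌊ toF x ≟F toF y ⌋

open FinGroup public

module _ (G H : FinGroup) where
  private
    module G = FinGroup G
    module H = FinGroup H
    module GI = IsGroup G.isGroup
    module HI = IsGroup H.isGroup

  prodIsGroup : IsGroup {A = G.Carrier × H.Carrier} _≡_
      (λ x y → (G._∙_ (proj₁ x) (proj₁ y)) , H._∙_ (proj₂ x) (proj₂ y))
      (G.ε , H.ε)
      (λ x → G._⁻¹ (proj₁ x) , H._⁻¹ (proj₂ x))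
  prodIsGroup = record
    { isMonoid = record
      { isSemigroup = record
        { isMagma = record
          { isEquivalence = isEquivalence
          ; ∙-cong = λ { refl refl → refl } }
        ; assoc = λ x y z → cong₂ _,_ (GI.assoc _ _ _) (HI.assoc _ _ _) }
      ; identity = (λ x → cong₂ _,_ (proj₁ GI.identity _) (proj₁ HI.identity _))
                 , (λ x → cong₂ _,_ (proj₂ GI.identity _) (proj₂ HI.identity _)) }
    ; inverse = (λ x → cong₂ _,_ (proj₁ GI.inverse _) (proj₁ HI.inverse _))
              , (λ x → cong₂ _,_ (proj₂ GI.inverse _) (proj₂ HI.inverse _))
    ; ⁻¹-cong = λ { refl → refl } }

  _⊗_ : FinGroup
  _⊗_ = record
    { Carrier = G.Carrier × H.Carrier
    ; _∙_ = λ x y → (G._∙_ (proj₁ x) (proj₁ y)) , H._∙_ (proj₂ x) (proj₂ y)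
    ; ε = G.ε , H.ε
    ; _⁻¹ = λ x → G._⁻¹ (proj₁ x) , H._⁻¹ (proj₂ x)
    ; isGroup = prodIsGroup
    ; order = G.order * H.order
    ; enum = ↔-trans (G.enum ×-↔ H.enum) (↔-sym *↔×)
    }

countFin : (n : ℕ) → (Fin n → Bool) → ℕ
countFin zero    P = 0
countFin (suc n) P = (if P zero then 1 else 0) + countFin n (λ i → P (suc i))

countG : (G : FinGroup) → (Carrier G → Bool) → ℕ
countG G P = countFin (order G) (λ i → P (fromF G i))

Subset : FinGroup → Set
Subset G = Carrier G → Bool

complement : (G : FinGroup) → Subset G → Subset G
complement G D x = not (D x)

sumFin : (n : ℕ) → (Fin n → ℕ) → ℕ
sumFin zero    f = 0
sumFin (suc n) f = f zero + sumFin n (λ i → f (suc i))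

sumG : (G : FinGroup) → (Carrier G → ℕ) → ℕ
sumG G f = sumFin (order G) (λ i → f (fromF G i))

diffCount : (G : FinGroup) → Subset G → Carrier G → ℕ
diffCount G D g =
  sumG G (λ d₁ → countG G (λ d₂ → D d₁ ∧ D d₂ ∧ eqB G (_∙_ G d₁ (_⁻¹ G d₂)) g))

-- (v,k,λ) difference set, with v = order G: |D| = k and every
-- non-identity g occurs exactly λ times as d₁ d₂⁻¹.
IsDiffSet : (G : FinGroup) → Subset G → (k lam : ℕ) → Set
IsDiffSet G D k lam =
  countG G D ≡ k × (∀ g → g ≢ ε G → diffCount G D g ≡ lam)

DiffSet : (G : FinGroup) → Subset G → Set
DiffSet G D = Σ ℕ λ k → Σ ℕ λ lam → IsDiffSet G D k lam

record Design : Set₁ where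
  field
    Point : Set
    Block : Set
    inc   : Point → Block → Bool

open Design public

-- development of D: points G, blocks the left translates gD (indexed by g),
-- x ∈ gD iff g⁻¹x ∈ D
dev : (G : FinGroup) → Subset G → Design
dev G D = record
  { Point = Carrier G
  ; Block = Carrier G
  ; inc = λ x g → D (_∙_ G (_⁻¹ G g) x) }

SDP : Design → Set
SDP S = ∀ b₁ b₂ b₃ → Σ (Block S) λ b →
  (∀ x → (inc S x b₁ xor inc S x b₂ xor inc S x b₃) ≡ inc S x b)
  ⊎ (∀ x → (inc S x b₁ xor inc S x b₂ xor inc S x b₃) ≡ not (inc S x b))

SDPDiffSet : (G : FinGroup) → Subset G → Set
SDPDiffSet G D = DiffSet G D × SDP (dev G D)

_≅D_ : Design → Design → Set
S ≅D T = Σ (Point S ↔ Point T) λ σ → Σ (Block S ↔ Block T) λ τ →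
  ∀ p b → inc S p b ≡ inc T (Inverse.to σ p) (Inverse.to τ b)

prodDS : (G₁ G₂ : FinGroup) → Subset G₁ → Subset G₂ → Subset (G₁ ⊗ G₂)
prodDS G₁ G₂ D₁ D₂ x =
  (D₁ (proj₁ x) ∧ complement G₂ D₂ (proj₂ x))
  ∨ (complement G₁ D₁ (proj₁ x) ∧ D₂ (proj₂ x))

{-# OPTIONS --safe #-}
-- The development of D is, as an incidence structure, the product of the
-- developments of D₁ and D₂: a point (x₁,x₂) lies on the block (g₁,g₂) iff
-- exactly one of x₁ ∈ g₁D₁, x₂ ∈ g₂D₂ holds.  Isomorphisms of the two
-- factors therefore combine coordinatewise into an isomorphism of products.
module Submission where

open import Defs
open import Data.Nat using (ℕ; _*_; _^_)
open import Data.Bool using (Bool; _∧_; _∨_; not)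
open import Data.Product using (_×_; _,_; proj₁; proj₂)
open import Data.Product.Function.NonDependent.Propositional using (_×-↔_)
open import Relation.Binary.PropositionalEquality using (_≡_; cong₂)

productDesign : (Bool → Bool → Bool) → Design → Design → Design
productDesign _⊕_ S T = record
  { Point = Point S × Point T
  ; Block = Block S × Block T
  ; inc   = λ p b → inc S (proj₁ p) (proj₁ b) ⊕ inc T (proj₂ p) (proj₂ b)
  }

≅D-productDesign : (_⊕_ : Bool → Bool → Bool) {S S′ T T′ : Design}
  → S ≅D S′ → T ≅D T′ → productDesign _⊕_ S T ≅D productDesign _⊕_ S′ T′
≅D-productDesign _⊕_ (σ₁ , τ₁ , inc₁) (σ₂ , τ₂ , inc₂) =
  (σ₁ ×-↔ σ₂) , (τ₁ ×-↔ τ₂) , λ p b →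
    cong₂ _⊕_ (inc₁ (proj₁ p) (proj₁ b)) (inc₂ (proj₂ p) (proj₂ b))

exactlyOne : Bool → Bool → Bool
exactlyOne a c = (a ∧ not c) ∨ (not a ∧ c)

theorem5p1 : (n : ℕ) (G₁ G₂ G₁′ G₂′ : FinGroup)
    → order (G₁ ⊗ G₂) ≡ 2 ^ (2 * n)
    → order (G₁′ ⊗ G₂′) ≡ 2 ^ (2 * n)
    → (D₁ : Subset G₁) (D₂ : Subset G₂) (D₁′ : Subset G₁′) (D₂′ : Subset G₂′)
    → SDPDiffSet G₁ D₁ → SDPDiffSet G₂ D₂
    → SDPDiffSet G₁′ D₁′ → SDPDiffSet G₂′ D₂′
    → SDPDiffSet (G₁ ⊗ G₂) (prodDS G₁ G₂ D₁ D₂)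
    → SDPDiffSet (G₁′ ⊗ G₂′) (prodDS G₁′ G₂′ D₁′ D₂′)
    → dev G₁ D₁ ≅D dev G₁′ D₁′
    → dev G₂ D₂ ≅D dev G₂′ D₂′
    → dev (G₁ ⊗ G₂) (prodDS G₁ G₂ D₁ D₂) ≅D dev (G₁′ ⊗ G₂′) (prodDS G₁′ G₂′ D₁′ D₂′)
-- dev (G₁ ⊗ G₂) (prodDS G₁ G₂ D₁ D₂) is definitionally
-- productDesign exactlyOne (dev G₁ D₁) (dev G₂ D₂).
theorem5p1 _ G₁ G₂ G₁′ G₂′ _ _ D₁ D₂ D₁′ D₂′ _ _ _ _ _ _ iso₁ iso₂ =
  ≅D-productDesign exactlyOne
    {dev G₁ D₁} {dev G₁′ D₁′} {dev G₂ D₂} {dev G₂′ D₂′} iso₁ iso₂
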